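{- Let $A=(a_{kl})$ be a real skew-symmetric $n\times n$ matrix, and let $1\le i<j\le n$ with $a_{ij}\neq 0$. Form the $n\times 2n$ matrix $(A,\ I_n)$, interchange the $i$-th column of $A$ with the $i$-th column of $I_n$ and the $j$-th column of $A$ with the $j$-th column of $I_n$, and then perform row operations to bring the resulting matrix to the form $(B,\ I_n)$ (that is, the right-hand $n\times n$ block becomes the identity). Then the (skew-symmetric) matrix $B=(b_{kl})$ satisfies, for all $k,l\in\{1,\ldots,n\}$: $$ b_{kl}=\begin{cases} -1/a_{ij} & k=i,\ l=j,\\ a_{lj}/a_{ij} & k=i,\ l\neq j,\ k\neq l,\\ a_{il}/a_{ij} & k=j,\ l\neq i,\ k\neq l,\\ a_{jk}/a_{ij} & l=i,\ k\neq j,\ k\neq l,\\ a_{ki}/a_{ij} & l=j,\ k\neq i,\ k\neq l,\\ 0 & k=l,\\ [a_{ij}a_{kl}]/a_{ij} & \#\{i,j,k,l\}=4. \end{cases} $$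
   Context: For a skew-symmetric $2m\times 2m$ matrix $(a_{pq})_{1\le p,q\le 2m}$, the Pfaffian is $\mathrm{Pf}=\sum_{\sigma\in S'_{2m}}\mathrm{sign}(\sigma)\prod_{t=1}^m a_{\sigma(2t-1)\sigma(2t)}$, where $S'_{2m}=\{\sigma\in S_{2m}: \sigma(2t-1)=\min_{2t-1\le r\le 2m}\sigma(r)\text{ for }1\le t\le m\}$. For $S\subseteq\{1,\ldots,n\}$, $A_S$ denotes the Pfaffian of the principal submatrix of $A$ with rows and columns indexed by $S$ (in increasing order). For pairwise distinct $i,j,k,l$, the symbol $[a_{ij}a_{kl}]$ denotes $\pm A_{\{i,j,k,l\}}$, with the sign chosen so that the term $a_{ij}a_{kl}$ appears with positive sign (i.e. when $A_{\{i,j,k,l\}}$ is expanded as a polynomial in the entries, using $a_{qp}=-a_{pq}$, the monomial $a_{ij}a_{kl}$ has coefficient $+1$ in $[a_{ij}a_{kl}]$). -}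

module Defs where

open import Level using (Level; _⊔_; suc)
open import Data.Nat using (ℕ)
open import Data.Fin using (Fin; _≟_)
open import Data.Bool using (Bool; if_then_else_; _∨_)
open import Data.Product using (_×_)
import Data.Fin
open import Relation.Nullary using (¬_; does)
open import Algebra.Bundles using (CommutativeRing)
import Algebra.Definitions.RawMonoid as RawMonoidDefs

record Field (c ℓ : Level) : Set (suc (c ⊔ ℓ)) where
  field
    commutativeRing : CommutativeRing c ℓ
  open CommutativeRing commutativeRing public
  field
    0≉1     : ¬ (0# ≈ 1#)
    _⁻¹     : (x : Carrier) → ¬ (x ≈ 0#) → Carrier
    ⁻¹-inverseʳ : (x : Carrier) (x≉0 : ¬ (x ≈ 0#)) → x * _⁻¹ x x≉0 ≈ 1#

module FieldMatrices {c ℓ : Level} (F : Field c ℓ) where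
  open Field F

  Mat : ℕ → ℕ → Set c
  Mat n m = Fin n → Fin m → Carrier

  open RawMonoidDefs +-rawMonoid using (sum) public

  _⊗_ : {n m p : ℕ} → Mat n m → Mat m p → Mat n p
  (X ⊗ Y) k l = sum (λ r → X k r * Y r l)

  I : (n : ℕ) → Mat n n
  I n k l = if does (k ≟ l) then 1# else 0#

  _≈ᴹ_ : {n m : ℕ} → Mat n m → Mat n m → Set ℓ
  X ≈ᴹ Y = ∀ k l → X k l ≈ Y k l

  -- skew-symmetric (alternating): a_{lk} = - a_{kl} and zero diagonal
  -- (for real matrices the zero diagonal follows from a_{kk} = - a_{kk})
  SkewSymmetric : {n : ℕ} → Mat n n → Set ℓ
  SkewSymmetric {n} A = (∀ k l → A l k ≈ - (A k l)) × (∀ k → A k k ≈ 0#)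

  -- Starting from the n × 2n matrix (A , I_n), swap column i of A with
  -- column i of I_n and column j of A with column j of I_n.
  -- swappedLeft / swappedRight are the left and right n × n blocks.
  isIJ : {n : ℕ} → Fin n → Fin n → Fin n → Bool
  isIJ i j l = does (l ≟ i) ∨ does (l ≟ j)

  swappedLeft : {n : ℕ} → Mat n n → Fin n → Fin n → Mat n n
  swappedLeft {n} A i j k l = if isIJ i j l then I n k l else A k l

  swappedRight : {n : ℕ} → Mat n n → Fin n → Fin n → Mat n n
  swappedRight {n} A i j k l = if isIJ i j l then A k l else I n k l

  -- Pfaffian of a 4 × 4 skew-symmetric matrix, from the defining sum
  -- over S'_4 = {1234 (+), 1324 (-), 1423 (+)}.
  pf4 : Mat 4 4 → Carrier
  pf4 X = X f0 f1 * X f2 f3 - X f0 f2 * X f1 f3 + X f0 f3 * X f1 f2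
    where f0 f1 f2 f3 : Fin 4
          f0 = Data.Fin.zero
          f1 = Data.Fin.suc Data.Fin.zero
          f2 = Data.Fin.suc (Data.Fin.suc Data.Fin.zero)
          f3 = Data.Fin.suc (Data.Fin.suc (Data.Fin.suc Data.Fin.zero))

  sub4 : {n : ℕ} → Mat n n → Fin n → Fin n → Fin n → Fin n → Mat 4 4
  sub4 A p q r s x y = A (pick x) (pick y)
    where pick : Fin 4 → Fin _
          pick Data.Fin.zero = p
          pick (Data.Fin.suc Data.Fin.zero) = q
          pick (Data.Fin.suc (Data.Fin.suc Data.Fin.zero)) = r
          pick (Data.Fin.suc (Data.Fin.suc (Data.Fin.suc _))) = s

  -- [a_{ij} a_{kl}] : the Pfaffian of the submatrix indexed by (i,j,k,l) in
  -- this order.  Reordering rows/columns by a permutation P multiplies the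
  -- Pfaffian by sign P, so this equals ± A_{{i,j,k,l}}, and the monomial
  -- a_{ij} a_{kl} appears in it with coefficient +1.
  bracket : {n : ℕ} → Mat n n → Fin n → Fin n → Fin n → Fin n → Carrier
  bracket A i j k l = pf4 (sub4 A i j k l)

-- The right block R agrees with the identity outside columns i and j, hence so does every M with
-- M R = I.  Row k of M A then involves only M k i, M k j and, when k ∉ {i, j}, the row of A itself;
-- as a_ii = a_jj = 0 and a_ji = - a_ij, the conditions (M A) k j = δ_kj and (M A) k i = δ_ki fix
-- M k i and M k j after division by a_ij, so M is unique and explicit.  Columns i and j of B = M L
-- are those of M, and every other entry is M k i a_il + M k j a_jl + a_kl, which for k, l ∉ {i, j}
-- equals [a_ij a_kl] / a_ij.

module Submission where

open import Defs
open import Algebra.Bundles using (CommutativeMonoid)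
open import Data.Bool using (true; false; if_then_else_)
open import Data.Bool.Properties using (∨-zeroʳ)
open import Data.Fin using (Fin; _<_; _≟_; punchIn; punchOut)
open import Data.Fin.Properties using (<⇒≢; punchInᵢ≢i; punchIn-injective; punchIn-punchOut; punchOut-injective)
open import Data.Nat using (ℕ; suc)
open import Data.Product using (Σ; _×_; _,_; proj₁; proj₂)
open import Data.Sum using (_⊎_; inj₁; inj₂; [_,_]′)
open import Data.Vec.Functional using (Vector; removeAt)
open import Function using (_∘_)
open import Relation.Binary.PropositionalEquality as ≡ using (_≡_; _≢_)
open import Relation.Nullary using (¬_; does; yes; no)
open import Relation.Nullary.Decidable using (dec-true; dec-false)
import Algebra.Properties.AbelianGroup as AbelianGroupProperties
import Algebra.Properties.CommutativeMonoid.Sum as CommutativeMonoidSum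
import Algebra.Properties.Ring as RingProperties
import Algebra.Solver.Ring.NaturalCoefficients.Default as NaturalCoefficientsSolver
import Relation.Binary.Reasoning.Setoid as SetoidReasoning

module FiniteSupport {a ℓ} (M : CommutativeMonoid a ℓ) where
  open CommutativeMonoid M
    renaming (_∙_ to _+_; ε to 0#; ∙-congˡ to +-congˡ; identityʳ to +-identityʳ; assoc to +-assoc)
  open CommutativeMonoidSum M using (sum; sum-remove; sum-cong-≋; sum-replicate-zero)
  open SetoidReasoning setoid

  sum-zero : ∀ {n} (f : Vector Carrier n) → (∀ r → f r ≈ 0#) → sum f ≈ 0#
  sum-zero {n} f f≈0 = trans (sum-cong-≋ f≈0) (sum-replicate-zero n)

  private
    punchIn≢ : ∀ {n} {p q : Fin (suc n)} (p≢q : p ≢ q) {r} → r ≢ punchOut p≢q → punchIn p r ≢ q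
    punchIn≢ {p = p} p≢q {r} r≢q′ e =
      r≢q′ (punchIn-injective p r _ (≡.trans e (≡.sym (punchIn-punchOut p≢q))))

  sum-support₁ : ∀ {n} (f : Vector Carrier n) p → (∀ r → r ≢ p → f r ≈ 0#) → sum f ≈ f p
  sum-support₁ {suc n} f p f≈0 = begin
    sum f                     ≈⟨ sum-remove {i = p} f ⟩
    f p + sum (removeAt f p)  ≈⟨ +-congˡ (sum-zero _ (λ r → f≈0 _ (punchInᵢ≢i p r))) ⟩
    f p + 0#                  ≈⟨ +-identityʳ _ ⟩
    f p                       ∎

  sum-support₂ : ∀ {n} (f : Vector Carrier n) {p q} → p ≢ q →
                 (∀ r → r ≢ p → r ≢ q → f r ≈ 0#) → sum f ≈ f p + f q
  sum-support₂ {suc n} f {p} {q} p≢q f≈0 = begin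
    sum f                     ≈⟨ sum-remove {i = p} f ⟩
    f p + sum (removeAt f p)  ≈⟨ +-congˡ (sum-support₁ (removeAt f p) _ removed≈0) ⟩
    f p + f (punchIn p q′)    ≡⟨ ≡.cong (λ r → f p + f r) (punchIn-punchOut p≢q) ⟩
    f p + f q                 ∎
    where
    q′ : Fin n
    q′ = punchOut p≢q
    removed≈0 : ∀ r → r ≢ q′ → f (punchIn p r) ≈ 0#
    removed≈0 r r≢q′ = f≈0 _ (punchInᵢ≢i p r) (punchIn≢ p≢q r≢q′)

  sum-support₃ : ∀ {n} (f : Vector Carrier n) {p q s} → p ≢ q → p ≢ s → q ≢ s →
                 (∀ r → r ≢ p → r ≢ q → r ≢ s → f r ≈ 0#) → sum f ≈ f p + f q + f s
  sum-support₃ {suc n} f {p} {q} {s} p≢q p≢s q≢s f≈0 = begin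
    sum f                                  ≈⟨ sum-remove {i = p} f ⟩
    f p + sum (removeAt f p)               ≈⟨ +-congˡ (sum-support₂ (removeAt f p) q′≢s′ removed≈0) ⟩
    f p + (f (punchIn p q′) + f (punchIn p s′))
      ≡⟨ ≡.cong₂ (λ x y → f p + (f x + f y)) (punchIn-punchOut p≢q) (punchIn-punchOut p≢s) ⟩
    f p + (f q + f s)                      ≈⟨ sym (+-assoc _ _ _) ⟩
    f p + f q + f s                        ∎
    where
    q′ s′ : Fin n
    q′ = punchOut p≢q
    s′ = punchOut p≢s
    q′≢s′ : q′ ≢ s′
    q′≢s′ = q≢s ∘ punchOut-injective p≢q p≢s
    removed≈0 : ∀ r → r ≢ q′ → r ≢ s′ → f (punchIn p r) ≈ 0#
    removed≈0 r r≢q′ r≢s′ = f≈0 _ (punchInᵢ≢i p r) (punchIn≢ p≢q r≢q′) (punchIn≢ p≢s r≢s′)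

module MatrixProperties {c ℓ} (F : Field c ℓ) where
  open Field F
  open FieldMatrices F
  open FiniteSupport +-commutativeMonoid using (sum-support₁)
  open CommutativeMonoidSum +-commutativeMonoid using (sum-cong-≋; sum-cong-≗)

  I-diag : ∀ {n} (k : Fin n) → I n k k ≡ 1#
  I-diag k = ≡.cong (λ b → if b then 1# else 0#) (dec-true (k ≟ k) ≡.refl)

  I-off : ∀ {n} {k l : Fin n} → k ≢ l → I n k l ≡ 0#
  I-off {k = k} {l} k≢l = ≡.cong (λ b → if b then 1# else 0#) (dec-false (k ≟ l) k≢l)

  ⊗-identityʳ : ∀ {n m} (M : Mat n m) k l → (M ⊗ I m) k l ≈ M k l
  ⊗-identityʳ M k l = trans (sum-support₁ _ l off-l≈0) (trans (*-congˡ (reflexive (I-diag l))) (*-identityʳ _))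
    where
    off-l≈0 : ∀ r → r ≢ l → M k r * I _ r l ≈ 0#
    off-l≈0 r r≢l = trans (*-congˡ (reflexive (I-off r≢l))) (zeroʳ _)

  ⊗-congʳ : ∀ {n m p} {M M′ : Mat n m} (X : Mat m p) → M ≈ᴹ M′ → (M ⊗ X) ≈ᴹ (M′ ⊗ X)
  ⊗-congʳ X M≈M′ k l = sum-cong-≋ (λ r → *-congʳ (M≈M′ k r))

  skewSymmetric-resp : ∀ {n} {X Y : Mat n n} → X ≈ᴹ Y → SkewSymmetric Y → SkewSymmetric X
  skewSymmetric-resp X≈Y (antisym , diag) =
    (λ k l → trans (X≈Y l k) (trans (antisym k l) (-‿cong (sym (X≈Y k l))))) ,
    (λ k → trans (X≈Y k k) (diag k))

  ⊗-column-cong : ∀ {n m p} (M : Mat n m) (X Y : Mat m p) {l} → (∀ r → X r l ≡ Y r l) →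
                  ∀ k → (M ⊗ X) k l ≡ (M ⊗ Y) k l
  ⊗-column-cong M X Y X≡Y k = sum-cong-≗ (λ r → ≡.cong (M k r *_) (X≡Y r))

module FieldProperties {c ℓ} (F : Field c ℓ) where
  open Field F
  open SetoidReasoning setoid

  ⁻¹-inverseˡ : ∀ x (x≉0 : ¬ x ≈ 0#) → (x ⁻¹) x≉0 * x ≈ 1#
  ⁻¹-inverseˡ x x≉0 = trans (*-comm _ x) (⁻¹-inverseʳ x x≉0)

  x*y*y⁻¹≈x : ∀ x {y} (y≉0 : ¬ y ≈ 0#) → x * y * (y ⁻¹) y≉0 ≈ x
  x*y*y⁻¹≈x x {y} y≉0 = begin
    x * y * (y ⁻¹) y≉0    ≈⟨ *-assoc x y _ ⟩
    x * (y * (y ⁻¹) y≉0)  ≈⟨ *-congˡ (⁻¹-inverseʳ y y≉0) ⟩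
    x * 1#                ≈⟨ *-identityʳ x ⟩
    x                     ∎

  x*y⁻¹*y≈x : ∀ x {y} (y≉0 : ¬ y ≈ 0#) → x * (y ⁻¹) y≉0 * y ≈ x
  x*y⁻¹*y≈x x {y} y≉0 = begin
    x * (y ⁻¹) y≉0 * y    ≈⟨ *-assoc x _ y ⟩
    x * ((y ⁻¹) y≉0 * y)  ≈⟨ *-congˡ (⁻¹-inverseˡ y y≉0) ⟩
    x * 1#                ≈⟨ *-identityʳ x ⟩
    x                     ∎

  *-cancelʳ-nonZero : ∀ {x} (x≉0 : ¬ x ≈ 0#) {y z} → y * x ≈ z * x → y ≈ z
  *-cancelʳ-nonZero {x} x≉0 {y} {z} yx≈zx = begin
    y                     ≈⟨ x*y*y⁻¹≈x y x≉0 ⟨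
    y * x * (x ⁻¹) x≉0    ≈⟨ *-congʳ yx≈zx ⟩
    z * x * (x ⁻¹) x≉0    ≈⟨ x*y*y⁻¹≈x z x≉0 ⟩
    z                     ∎

module Swap {c ℓ} (F : Field c ℓ) {n : ℕ} (A : FieldMatrices.Mat F n n) (i j : Fin n) (i≢j : i ≢ j) where
  open Field F
  open FieldMatrices F
  open MatrixProperties F
  open FiniteSupport +-commutativeMonoid using (sum-support₂; sum-support₃)

  j≢i : j ≢ i
  j≢i = i≢j ∘ ≡.sym

  data Place : Fin n → Set where
    at-i : Place i
    at-j : Place j
    off  : ∀ {k} → k ≢ i → k ≢ j → Place k

  place : ∀ k → Place k
  place k with k ≟ i | k ≟ j
  ... | yes ≡.refl | _          = at-i
  ... | no _       | yes ≡.refl = at-j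
  ... | no k≢i     | no k≢j     = off k≢i k≢j

  caseᵢⱼ : ∀ {b} {B : Set b} → B → B → B → Fin n → B
  caseᵢⱼ x y z k = if does (k ≟ i) then x else if does (k ≟ j) then y else z

  caseᵢⱼ-i : ∀ {b} {B : Set b} {x y z : B} → caseᵢⱼ x y z i ≡ x
  caseᵢⱼ-i rewrite dec-true (i ≟ i) ≡.refl = ≡.refl

  caseᵢⱼ-j : ∀ {b} {B : Set b} {x y z : B} → caseᵢⱼ x y z j ≡ y
  caseᵢⱼ-j rewrite dec-false (j ≟ i) j≢i | dec-true (j ≟ j) ≡.refl = ≡.refl

  caseᵢⱼ-off : ∀ {b} {B : Set b} {x y z : B} {k} → k ≢ i → k ≢ j → caseᵢⱼ x y z k ≡ z
  caseᵢⱼ-off {k = k} k≢i k≢j rewrite dec-false (k ≟ i) k≢i | dec-false (k ≟ j) k≢j = ≡.refl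

  isIJ-pair : ∀ {l} → l ≡ i ⊎ l ≡ j → isIJ i j l ≡ true
  isIJ-pair (inj₁ ≡.refl) rewrite dec-true (i ≟ i) ≡.refl = ≡.refl
  isIJ-pair (inj₂ ≡.refl) rewrite dec-true (j ≟ j) ≡.refl = ∨-zeroʳ _

  isIJ-off : ∀ {l} → l ≢ i → l ≢ j → isIJ i j l ≡ false
  isIJ-off {l} l≢i l≢j rewrite dec-false (l ≟ i) l≢i | dec-false (l ≟ j) l≢j = ≡.refl

  R L : Mat n n
  R = swappedRight A i j
  L = swappedLeft A i j

  R-pair : ∀ {l} → l ≡ i ⊎ l ≡ j → ∀ r → R r l ≡ A r l
  R-pair {l} l∈ij r = ≡.cong (λ b → if b then A r l else I n r l) (isIJ-pair l∈ij)

  R-off : ∀ {l} → l ≢ i → l ≢ j → ∀ r → R r l ≡ I n r l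
  R-off {l} l≢i l≢j r = ≡.cong (λ b → if b then A r l else I n r l) (isIJ-off l≢i l≢j)

  L-pair : ∀ {l} → l ≡ i ⊎ l ≡ j → ∀ r → L r l ≡ I n r l
  L-pair {l} l∈ij r = ≡.cong (λ b → if b then I n r l else A r l) (isIJ-pair l∈ij)

  L-off : ∀ {l} → l ≢ i → l ≢ j → ∀ r → L r l ≡ A r l
  L-off {l} l≢i l≢j r = ≡.cong (λ b → if b then I n r l else A r l) (isIJ-off l≢i l≢j)

  ⊗R-pair : ∀ (M : Mat n n) {l} → l ≡ i ⊎ l ≡ j → ∀ k → (M ⊗ R) k l ≡ (M ⊗ A) k l
  ⊗R-pair M l∈ij = ⊗-column-cong M R A (R-pair l∈ij)

  ⊗R-off : ∀ (M : Mat n n) {l} → l ≢ i → l ≢ j → ∀ k → (M ⊗ R) k l ≈ M k l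
  ⊗R-off M {l} l≢i l≢j k = trans (reflexive (⊗-column-cong M R (I n) (R-off l≢i l≢j) k)) (⊗-identityʳ M k l)

  ⊗L-pair : ∀ (M : Mat n n) {l} → l ≡ i ⊎ l ≡ j → ∀ k → (M ⊗ L) k l ≈ M k l
  ⊗L-pair M {l} l∈ij k = trans (reflexive (⊗-column-cong M L (I n) (L-pair l∈ij) k)) (⊗-identityʳ M k l)

  ⊗L-off : ∀ (M : Mat n n) {l} → l ≢ i → l ≢ j → ∀ k → (M ⊗ L) k l ≡ (M ⊗ A) k l
  ⊗L-off M l≢i l≢j = ⊗-column-cong M L A (L-off l≢i l≢j)

  IdentityOffᵢⱼ : Mat n n → Set ℓ
  IdentityOffᵢⱼ M = ∀ k r → r ≢ i → r ≢ j → M k r ≈ I n k r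

  module _ {M : Mat n n} (idOff : IdentityOffᵢⱼ M) {p} (X : Mat n p) where

    ⊗-row-pair : ∀ {k} → k ≡ i ⊎ k ≡ j → ∀ l → (M ⊗ X) k l ≈ M k i * X i l + M k j * X j l
    ⊗-row-pair {k} k∈ij l = sum-support₂ _ i≢j outside≈0
      where
      k≢ : ∀ {r} → r ≢ i → r ≢ j → k ≢ r
      k≢ r≢i r≢j ≡.refl = [ r≢i , r≢j ]′ k∈ij
      outside≈0 : ∀ r → r ≢ i → r ≢ j → M k r * X r l ≈ 0#
      outside≈0 r r≢i r≢j = trans (*-congʳ (trans (idOff k r r≢i r≢j) (reflexive (I-off (k≢ r≢i r≢j))))) (zeroˡ _)

    ⊗-row-off : ∀ {k} → k ≢ i → k ≢ j → ∀ l → (M ⊗ X) k l ≈ M k i * X i l + M k j * X j l + X k l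
    ⊗-row-off {k} k≢i k≢j l =
      trans (sum-support₃ _ i≢j (k≢i ∘ ≡.sym) (k≢j ∘ ≡.sym) outside≈0) (+-congˡ diagonal)
      where
      outside≈0 : ∀ r → r ≢ i → r ≢ j → r ≢ k → M k r * X r l ≈ 0#
      outside≈0 r r≢i r≢j r≢k =
        trans (*-congʳ (trans (idOff k r r≢i r≢j) (reflexive (I-off (r≢k ∘ ≡.sym))))) (zeroˡ _)
      diagonal : M k k * X k l ≈ X k l
      diagonal = trans (*-congʳ (trans (idOff k k k≢i k≢j) (reflexive (I-diag k)))) (*-identityˡ _)

  ⊗R≈I⇒identityOff : ∀ {M} → (M ⊗ R) ≈ᴹ I n → IdentityOffᵢⱼ M
  ⊗R≈I⇒identityOff {M} MR≈I k r r≢i r≢j = trans (sym (⊗R-off M r≢i r≢j k)) (MR≈I k r)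

  ⊗R≈I⇒⊗A≈I : ∀ {M} → (M ⊗ R) ≈ᴹ I n → ∀ {l} → l ≡ i ⊎ l ≡ j → ∀ k → (M ⊗ A) k l ≈ I n k l
  ⊗R≈I⇒⊗A≈I {M} MR≈I l∈ij k = trans (reflexive (≡.sym (⊗R-pair M l∈ij k))) (MR≈I k _)

  ⊗A≈I⇒⊗R≈I : ∀ {M} → IdentityOffᵢⱼ M → (∀ k → (M ⊗ A) k i ≈ I n k i) → (∀ k → (M ⊗ A) k j ≈ I n k j) →
              (M ⊗ R) ≈ᴹ I n
  ⊗A≈I⇒⊗R≈I {M} idOff col-i col-j k l with place l
  ... | at-i        = trans (reflexive (⊗R-pair M (inj₁ ≡.refl) k)) (col-i k)
  ... | at-j        = trans (reflexive (⊗R-pair M (inj₂ ≡.refl) k)) (col-j k)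
  ... | off l≢i l≢j = trans (⊗R-off M l≢i l≢j k) (idOff k l l≢i l≢j)

module Pivot {c ℓ} (F : Field c ℓ) {n : ℕ} (A : FieldMatrices.Mat F n n) (i j : Fin n)
             (skew : FieldMatrices.SkewSymmetric F A) (i≢j : i ≢ j)
             (aᵢⱼ≉0 : ¬ Field._≈_ F (A i j) (Field.0# F)) where
  open Field F
  open FieldMatrices F
  open MatrixProperties F
  open FieldProperties F
  open Swap F A i j i≢j
  open RingProperties ring using (-‿distribˡ-*; -‿distribʳ-*)
  open AbelianGroupProperties +-abelianGroup using (ε⁻¹≈ε; ⁻¹-involutive; ⁻¹-injective; ⁻¹-selfInverse; ⁻¹-∙-comm; ∙-cancelʳ; //-rightDividesˡ)
  open NaturalCoefficientsSolver commutativeSemiring using (solve; _:=_; _:+_; _:*_)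
  open SetoidReasoning setoid

  a a⁻¹ : Carrier
  a = A i j
  a⁻¹ = (a ⁻¹) aᵢⱼ≉0

  antisym : ∀ k l → A l k ≈ - A k l
  antisym = proj₁ skew

  diag : ∀ k → A k k ≈ 0#
  diag = proj₂ skew

  i-column-terms : ∀ x y → x * A i i + y * A j i ≈ - (y * a)
  i-column-terms x y = begin
    x * A i i + y * A j i  ≈⟨ +-cong (*-congˡ (diag i)) (*-congˡ (antisym i j)) ⟩
    x * 0# + y * - a       ≈⟨ +-congʳ (zeroʳ x) ⟩
    0# + y * - a           ≈⟨ +-identityˡ _ ⟩
    y * - a                ≈⟨ -‿distribʳ-* y a ⟨
    - (y * a)              ∎

  j-column-terms : ∀ x y → x * A i j + y * A j j ≈ x * a
  j-column-terms x y = trans (+-congˡ (trans (*-congˡ (diag j)) (zeroʳ y))) (+-identityʳ _)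

  module _ {M : Mat n n} (idOff : IdentityOffᵢⱼ M) where

    ⊗A-i-pair : ∀ {k} → k ≡ i ⊎ k ≡ j → (M ⊗ A) k i ≈ - (M k j * a)
    ⊗A-i-pair k∈ij = trans (⊗-row-pair idOff A k∈ij i) (i-column-terms _ _)

    ⊗A-i-off : ∀ {k} → k ≢ i → k ≢ j → (M ⊗ A) k i ≈ - (M k j * a) + A k i
    ⊗A-i-off k≢i k≢j = trans (⊗-row-off idOff A k≢i k≢j i) (+-congʳ (i-column-terms _ _))

    ⊗A-j-pair : ∀ {k} → k ≡ i ⊎ k ≡ j → (M ⊗ A) k j ≈ M k i * a
    ⊗A-j-pair k∈ij = trans (⊗-row-pair idOff A k∈ij j) (j-column-terms _ _)

    ⊗A-j-off : ∀ {k} → k ≢ i → k ≢ j → (M ⊗ A) k j ≈ M k i * a + A k j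
    ⊗A-j-off k≢i k≢j = trans (⊗-row-off idOff A k≢i k≢j j) (+-congʳ (j-column-terms _ _))

  leftInverse : Mat n n
  leftInverse k l = caseᵢⱼ (caseᵢⱼ 0# a⁻¹ (A j k * a⁻¹) k) (caseᵢⱼ (- a⁻¹) 0# (A k i * a⁻¹) k) (I n k l) l

  leftInverse-identityOff : IdentityOffᵢⱼ leftInverse
  leftInverse-identityOff k r r≢i r≢j = reflexive (caseᵢⱼ-off r≢i r≢j)

  leftInverse-ii : leftInverse i i ≡ 0#
  leftInverse-ii = ≡.trans caseᵢⱼ-i caseᵢⱼ-i

  leftInverse-ji : leftInverse j i ≡ a⁻¹
  leftInverse-ji = ≡.trans caseᵢⱼ-i caseᵢⱼ-j

  leftInverse-ki : ∀ {k} → k ≢ i → k ≢ j → leftInverse k i ≡ A j k * a⁻¹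
  leftInverse-ki k≢i k≢j = ≡.trans caseᵢⱼ-i (caseᵢⱼ-off k≢i k≢j)

  leftInverse-ij : leftInverse i j ≡ - a⁻¹
  leftInverse-ij = ≡.trans caseᵢⱼ-j caseᵢⱼ-i

  leftInverse-jj : leftInverse j j ≡ 0#
  leftInverse-jj = ≡.trans caseᵢⱼ-j caseᵢⱼ-j

  leftInverse-kj : ∀ {k} → k ≢ i → k ≢ j → leftInverse k j ≡ A k i * a⁻¹
  leftInverse-kj k≢i k≢j = ≡.trans caseᵢⱼ-j (caseᵢⱼ-off k≢i k≢j)

  private
    N : Mat n n
    N = leftInverse

    idOffN : IdentityOffᵢⱼ N
    idOffN = leftInverse-identityOff

  leftInverse-⊗A-i : ∀ k → (leftInverse ⊗ A) k i ≈ I n k i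
  leftInverse-⊗A-i k with place k
  ... | at-i = begin
    (N ⊗ A) i i      ≈⟨ ⊗A-i-pair idOffN (inj₁ ≡.refl) ⟩
    - (N i j * a)    ≡⟨ ≡.cong (λ x → - (x * a)) leftInverse-ij ⟩
    - (- a⁻¹ * a)    ≈⟨ -‿cong (-‿distribˡ-* a⁻¹ a) ⟨
    - - (a⁻¹ * a)    ≈⟨ ⁻¹-involutive _ ⟩
    a⁻¹ * a          ≈⟨ ⁻¹-inverseˡ a aᵢⱼ≉0 ⟩
    1#               ≡⟨ I-diag i ⟨
    I n i i          ∎
  ... | at-j = begin
    (N ⊗ A) j i      ≈⟨ ⊗A-i-pair idOffN (inj₂ ≡.refl) ⟩
    - (N j j * a)    ≡⟨ ≡.cong (λ x → - (x * a)) leftInverse-jj ⟩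
    - (0# * a)       ≈⟨ -‿cong (zeroˡ a) ⟩
    - 0#             ≈⟨ ε⁻¹≈ε ⟩
    0#               ≡⟨ I-off j≢i ⟨
    I n j i          ∎
  ... | off k≢i k≢j = begin
    (N ⊗ A) k i                  ≈⟨ ⊗A-i-off idOffN k≢i k≢j ⟩
    - (N k j * a) + A k i        ≡⟨ ≡.cong (λ x → - (x * a) + A k i) (leftInverse-kj k≢i k≢j) ⟩
    - (A k i * a⁻¹ * a) + A k i  ≈⟨ +-congʳ (-‿cong (x*y⁻¹*y≈x (A k i) aᵢⱼ≉0)) ⟩
    - A k i + A k i              ≈⟨ -‿inverseˡ (A k i) ⟩
    0#                           ≡⟨ I-off k≢i ⟨
    I n k i                      ∎

  leftInverse-⊗A-j : ∀ k → (leftInverse ⊗ A) k j ≈ I n k j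
  leftInverse-⊗A-j k with place k
  ... | at-i = begin
    (N ⊗ A) i j      ≈⟨ ⊗A-j-pair idOffN (inj₁ ≡.refl) ⟩
    N i i * a        ≡⟨ ≡.cong (_* a) leftInverse-ii ⟩
    0# * a           ≈⟨ zeroˡ a ⟩
    0#               ≡⟨ I-off i≢j ⟨
    I n i j          ∎
  ... | at-j = begin
    (N ⊗ A) j j      ≈⟨ ⊗A-j-pair idOffN (inj₂ ≡.refl) ⟩
    N j i * a        ≡⟨ ≡.cong (_* a) leftInverse-ji ⟩
    a⁻¹ * a          ≈⟨ ⁻¹-inverseˡ a aᵢⱼ≉0 ⟩
    1#               ≡⟨ I-diag j ⟨
    I n j j          ∎
  ... | off k≢i k≢j = begin
    (N ⊗ A) k j                  ≈⟨ ⊗A-j-off idOffN k≢i k≢j ⟩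
    N k i * a + A k j            ≡⟨ ≡.cong (λ x → x * a + A k j) (leftInverse-ki k≢i k≢j) ⟩
    A j k * a⁻¹ * a + A k j      ≈⟨ +-congʳ (trans (x*y⁻¹*y≈x (A j k) aᵢⱼ≉0) (antisym k j)) ⟩
    - A k j + A k j              ≈⟨ -‿inverseˡ (A k j) ⟩
    0#                           ≡⟨ I-off k≢j ⟨
    I n k j                      ∎

  leftInverse-⊗R : (leftInverse ⊗ R) ≈ᴹ I n
  leftInverse-⊗R = ⊗A≈I⇒⊗R≈I idOffN leftInverse-⊗A-i leftInverse-⊗A-j

  module _ {M : Mat n n} (MR≈I : (M ⊗ R) ≈ᴹ I n) where
    private
      idOffM : IdentityOffᵢⱼ M
      idOffM = ⊗R≈I⇒identityOff MR≈I

      agree : ∀ {l} → l ≡ i ⊎ l ≡ j → ∀ {k x y} → (M ⊗ A) k l ≈ x → (N ⊗ A) k l ≈ y → x ≈ y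
      agree {l} l∈ij {k} {x} {y} MA≈x NA≈y = begin
        x            ≈⟨ MA≈x ⟨
        (M ⊗ A) k l  ≈⟨ ⊗R≈I⇒⊗A≈I MR≈I l∈ij k ⟩
        I n k l      ≈⟨ ⊗R≈I⇒⊗A≈I leftInverse-⊗R l∈ij k ⟨
        (N ⊗ A) k l  ≈⟨ NA≈y ⟩
        y            ∎

    column-i-unique : ∀ k → M k i ≈ N k i
    column-i-unique k with place k
    ... | at-i        = *-cancelʳ-nonZero aᵢⱼ≉0
                          (agree (inj₂ ≡.refl) (⊗A-j-pair idOffM (inj₁ ≡.refl)) (⊗A-j-pair idOffN (inj₁ ≡.refl)))
    ... | at-j        = *-cancelʳ-nonZero aᵢⱼ≉0
                          (agree (inj₂ ≡.refl) (⊗A-j-pair idOffM (inj₂ ≡.refl)) (⊗A-j-pair idOffN (inj₂ ≡.refl)))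
    ... | off k≢i k≢j = *-cancelʳ-nonZero aᵢⱼ≉0 (∙-cancelʳ _ _ _
                          (agree (inj₂ ≡.refl) (⊗A-j-off idOffM k≢i k≢j) (⊗A-j-off idOffN k≢i k≢j)))

    column-j-unique : ∀ k → M k j ≈ N k j
    column-j-unique k with place k
    ... | at-i        = *-cancelʳ-nonZero aᵢⱼ≉0 (⁻¹-injective
                          (agree (inj₁ ≡.refl) (⊗A-i-pair idOffM (inj₁ ≡.refl)) (⊗A-i-pair idOffN (inj₁ ≡.refl))))
    ... | at-j        = *-cancelʳ-nonZero aᵢⱼ≉0 (⁻¹-injective
                          (agree (inj₁ ≡.refl) (⊗A-i-pair idOffM (inj₂ ≡.refl)) (⊗A-i-pair idOffN (inj₂ ≡.refl))))
    ... | off k≢i k≢j = *-cancelʳ-nonZero aᵢⱼ≉0 (⁻¹-injective (∙-cancelʳ _ _ _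
                          (agree (inj₁ ≡.refl) (⊗A-i-off idOffM k≢i k≢j) (⊗A-i-off idOffN k≢i k≢j))))

    leftInverse-unique : M ≈ᴹ leftInverse
    leftInverse-unique k l with place l
    ... | at-i        = column-i-unique k
    ... | at-j        = column-j-unique k
    ... | off l≢i l≢j = trans (idOffM k l l≢i l≢j) (sym (idOffN k l l≢i l≢j))

  pivoted : Mat n n
  pivoted = leftInverse ⊗ L

  ⊗L≈pivoted : ∀ {M} → (M ⊗ R) ≈ᴹ I n → (M ⊗ L) ≈ᴹ pivoted
  ⊗L≈pivoted MR≈I = ⊗-congʳ L (leftInverse-unique MR≈I)

  pivoted-ij : pivoted i j ≈ - a⁻¹
  pivoted-ij = trans (⊗L-pair N (inj₂ ≡.refl) i) (reflexive leftInverse-ij)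

  pivoted-ji : pivoted j i ≈ a⁻¹
  pivoted-ji = trans (⊗L-pair N (inj₁ ≡.refl) j) (reflexive leftInverse-ji)

  pivoted-ii : pivoted i i ≈ 0#
  pivoted-ii = trans (⊗L-pair N (inj₁ ≡.refl) i) (reflexive leftInverse-ii)

  pivoted-jj : pivoted j j ≈ 0#
  pivoted-jj = trans (⊗L-pair N (inj₂ ≡.refl) j) (reflexive leftInverse-jj)

  pivoted-ki : ∀ {k} → k ≢ i → k ≢ j → pivoted k i ≈ A j k * a⁻¹
  pivoted-ki {k} k≢i k≢j = trans (⊗L-pair N (inj₁ ≡.refl) k) (reflexive (leftInverse-ki k≢i k≢j))

  pivoted-kj : ∀ {k} → k ≢ i → k ≢ j → pivoted k j ≈ A k i * a⁻¹
  pivoted-kj {k} k≢i k≢j = trans (⊗L-pair N (inj₂ ≡.refl) k) (reflexive (leftInverse-kj k≢i k≢j))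

  pivoted-il : ∀ {l} → l ≢ i → l ≢ j → pivoted i l ≈ A l j * a⁻¹
  pivoted-il {l} l≢i l≢j = begin
    pivoted i l                    ≡⟨ ⊗L-off N l≢i l≢j i ⟩
    (N ⊗ A) i l                    ≈⟨ ⊗-row-pair idOffN A (inj₁ ≡.refl) l ⟩
    N i i * A i l + N i j * A j l  ≡⟨ ≡.cong₂ (λ x y → x * A i l + y * A j l) leftInverse-ii leftInverse-ij ⟩
    0# * A i l + - a⁻¹ * A j l     ≈⟨ trans (+-congʳ (zeroˡ _)) (+-identityˡ _) ⟩
    - a⁻¹ * A j l                  ≈⟨ -‿distribˡ-* a⁻¹ (A j l) ⟨
    - (a⁻¹ * A j l)                ≈⟨ -‿distribʳ-* a⁻¹ (A j l) ⟩
    a⁻¹ * - A j l                  ≈⟨ *-congˡ (antisym j l) ⟨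
    a⁻¹ * A l j                    ≈⟨ *-comm a⁻¹ (A l j) ⟩
    A l j * a⁻¹                    ∎

  pivoted-jl : ∀ {l} → l ≢ i → l ≢ j → pivoted j l ≈ A i l * a⁻¹
  pivoted-jl {l} l≢i l≢j = begin
    pivoted j l                    ≡⟨ ⊗L-off N l≢i l≢j j ⟩
    (N ⊗ A) j l                    ≈⟨ ⊗-row-pair idOffN A (inj₂ ≡.refl) l ⟩
    N j i * A i l + N j j * A j l  ≡⟨ ≡.cong₂ (λ x y → x * A i l + y * A j l) leftInverse-ji leftInverse-jj ⟩
    a⁻¹ * A i l + 0# * A j l       ≈⟨ trans (+-congˡ (zeroˡ _)) (+-identityʳ _) ⟩
    a⁻¹ * A i l                    ≈⟨ *-comm a⁻¹ (A i l) ⟩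
    A i l * a⁻¹                    ∎

  bracket-expanded : ∀ k l → bracket A i j k l ≈ a * A k l + A k i * A j l + A i l * A j k
  bracket-expanded k l = +-congʳ (+-congˡ (trans (-‿distribˡ-* (A i k) (A j l)) (*-congʳ (sym (antisym i k)))))

  pivoted-kl : ∀ {k l} → k ≢ i → k ≢ j → l ≢ i → l ≢ j → pivoted k l ≈ bracket A i j k l * a⁻¹
  pivoted-kl {k} {l} k≢i k≢j l≢i l≢j = begin
    pivoted k l                                                   ≡⟨ ⊗L-off N l≢i l≢j k ⟩
    (N ⊗ A) k l                                                   ≈⟨ ⊗-row-off idOffN A k≢i k≢j l ⟩
    N k i * A i l + N k j * A j l + A k l
      ≡⟨ ≡.cong₂ (λ x y → x * A i l + y * A j l + A k l) (leftInverse-ki k≢i k≢j) (leftInverse-kj k≢i k≢j) ⟩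
    A j k * a⁻¹ * A i l + A k i * a⁻¹ * A j l + A k l
      ≈⟨ +-congˡ (trans (*-congʳ (⁻¹-inverseʳ a aᵢⱼ≉0)) (*-identityˡ (A k l))) ⟨
    A j k * a⁻¹ * A i l + A k i * a⁻¹ * A j l + a * a⁻¹ * A k l
      ≈⟨ solve 7 (λ a v ajk ail aki ajl akl →
                    (ajk :* v :* ail :+ aki :* v :* ajl :+ a :* v :* akl)
                    := ((a :* akl :+ aki :* ajl :+ ail :* ajk) :* v))
                 refl a a⁻¹ (A j k) (A i l) (A k i) (A j l) (A k l) ⟩
    (a * A k l + A k i * A j l + A i l * A j k) * a⁻¹             ≈⟨ *-congʳ (bracket-expanded k l) ⟨
    bracket A i j k l * a⁻¹                                       ∎

  bracket-antisym : ∀ k l → bracket A i j l k ≈ - bracket A i j k l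
  bracket-antisym k l = begin
    bracket A i j l k                                    ≈⟨ bracket-expanded l k ⟩
    a * A l k + A l i * A j k + A i k * A j l
      ≈⟨ +-cong (+-cong (*-congˡ (antisym k l)) (*-congʳ (antisym i l))) (*-congʳ (antisym k i)) ⟩
    a * - A k l + - A i l * A j k + - A k i * A j l
      ≈⟨ +-cong (+-cong (-‿distribʳ-* a (A k l)) (-‿distribˡ-* (A i l) (A j k))) (-‿distribˡ-* (A k i) (A j l)) ⟨
    - (a * A k l) + - (A i l * A j k) + - (A k i * A j l)
      ≈⟨ trans (+-congʳ (⁻¹-∙-comm _ _)) (⁻¹-∙-comm _ _) ⟩
    - (a * A k l + A i l * A j k + A k i * A j l)
      ≈⟨ -‿cong (solve 3 (λ x y z → x :+ y :+ z := x :+ z :+ y) refl (a * A k l) (A i l * A j k) (A k i * A j l)) ⟩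
    - (a * A k l + A k i * A j l + A i l * A j k)        ≈⟨ -‿cong (bracket-expanded k l) ⟨
    - bracket A i j k l                                  ∎

  bracket-diag : ∀ k → bracket A i j k k ≈ 0#
  bracket-diag k = begin
    a * A k k - A i k * A j k + A i k * A j k  ≈⟨ //-rightDividesˡ (A i k * A j k) (a * A k k) ⟩
    a * A k k                                  ≈⟨ *-congˡ (diag k) ⟩
    a * 0#                                     ≈⟨ zeroʳ a ⟩
    0#                                         ∎

  pivoted-diag : ∀ k → pivoted k k ≈ 0#
  pivoted-diag k with place k
  ... | at-i        = pivoted-ii
  ... | at-j        = pivoted-jj
  ... | off k≢i k≢j = trans (pivoted-kl k≢i k≢j k≢i k≢j) (trans (*-congʳ (bracket-diag k)) (zeroˡ a⁻¹))

  private
    ≈0⇒≈-self : ∀ {x} → x ≈ 0# → x ≈ - x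
    ≈0⇒≈-self x≈0 = trans x≈0 (trans (sym ε⁻¹≈ε) (-‿cong (sym x≈0)))

    ≈-flip : ∀ {x y} → x ≈ - y → y ≈ - x
    ≈-flip x≈-y = sym (⁻¹-selfInverse (sym x≈-y))

    scaled-antisym : ∀ {x y u w} → x ≈ u * a⁻¹ → y ≈ w * a⁻¹ → u ≈ - w → x ≈ - y
    scaled-antisym {x} {y} {u} {w} x≈ua y≈wa u≈-w = begin
      x            ≈⟨ x≈ua ⟩
      u * a⁻¹      ≈⟨ *-congʳ u≈-w ⟩
      - w * a⁻¹    ≈⟨ -‿distribˡ-* w a⁻¹ ⟨
      - (w * a⁻¹)  ≈⟨ -‿cong y≈wa ⟨
      - y          ∎

    ji≈-ij : pivoted j i ≈ - pivoted i j
    ji≈-ij = trans pivoted-ji (trans (sym (⁻¹-involutive a⁻¹)) (-‿cong (sym pivoted-ij)))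

  pivoted-antisym : ∀ k l → pivoted l k ≈ - pivoted k l
  pivoted-antisym k l with place k | place l
  ... | at-i        | at-i        = ≈0⇒≈-self pivoted-ii
  ... | at-j        | at-j        = ≈0⇒≈-self pivoted-jj
  ... | at-i        | at-j        = ji≈-ij
  ... | at-j        | at-i        = ≈-flip ji≈-ij
  ... | at-i        | off l≢i l≢j = scaled-antisym (pivoted-ki l≢i l≢j) (pivoted-il l≢i l≢j) (antisym l j)
  ... | off k≢i k≢j | at-i        = ≈-flip (scaled-antisym (pivoted-ki k≢i k≢j) (pivoted-il k≢i k≢j) (antisym k j))
  ... | at-j        | off l≢i l≢j = scaled-antisym (pivoted-kj l≢i l≢j) (pivoted-jl l≢i l≢j) (antisym i l)
  ... | off k≢i k≢j | at-j        = ≈-flip (scaled-antisym (pivoted-kj k≢i k≢j) (pivoted-jl k≢i k≢j) (antisym i k))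
  ... | off k≢i k≢j | off l≢i l≢j =
    scaled-antisym (pivoted-kl l≢i l≢j k≢i k≢j) (pivoted-kl k≢i k≢j l≢i l≢j) (bracket-antisym k l)

  pivoted-skewSymmetric : SkewSymmetric pivoted
  pivoted-skewSymmetric = pivoted-antisym , pivoted-diag

mainTheorem2 : ∀ {c ℓ} (F : Field c ℓ) →
    let open Field F
        open FieldMatrices F
    in
    ∀ {n} (A : Mat n n) (i j : Fin n) →
    SkewSymmetric A → i < j → (aij≉0 : ¬ (A i j ≈ 0#)) →
    let inv = _⁻¹ (A i j) aij≉0
        L = swappedLeft A i j
        R = swappedRight A i j
    in
    -- row operations (left multiplication by M) can make the right block I_n
    (Σ (Mat n n) (λ M → (M ⊗ R) ≈ᴹ I n)) ×
    -- and whenever M (L , R) = (B , I_n), B is skew-symmetric with these entries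
    (∀ (M B : Mat n n) → (M ⊗ R) ≈ᴹ I n → (M ⊗ L) ≈ᴹ B →
      SkewSymmetric B ×
      (∀ k l →
        (k ≡ i → l ≡ j → B k l ≈ - inv) ×
        (k ≡ i → l ≢ j → k ≢ l → B k l ≈ A l j * inv) ×
        (k ≡ j → l ≢ i → k ≢ l → B k l ≈ A i l * inv) ×
        (l ≡ i → k ≢ j → k ≢ l → B k l ≈ A j k * inv) ×
        (l ≡ j → k ≢ i → k ≢ l → B k l ≈ A k i * inv) ×
        (k ≡ l → B k l ≈ 0#) ×
        (k ≢ i → k ≢ j → l ≢ i → l ≢ j → k ≢ l →
          B k l ≈ bracket A i j k l * inv)))
mainTheorem2 F A i j skew i<j aᵢⱼ≉0 = (leftInverse , leftInverse-⊗R) , λ M B MR≈I ML≈B →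
  let B≈ : ∀ k l → B k l ≈ pivoted k l
      B≈ k l = trans (sym (ML≈B k l)) (⊗L≈pivoted MR≈I k l)
  in skewSymmetric-resp B≈ pivoted-skewSymmetric , λ k l →
       (λ { ≡.refl ≡.refl → trans (B≈ i j) pivoted-ij }) ,
       (λ { ≡.refl l≢j i≢l → trans (B≈ i l) (pivoted-il (i≢l ∘ ≡.sym) l≢j) }) ,
       (λ { ≡.refl l≢i j≢l → trans (B≈ j l) (pivoted-jl l≢i (j≢l ∘ ≡.sym)) }) ,
       (λ { ≡.refl k≢j k≢i → trans (B≈ k i) (pivoted-ki k≢i k≢j) }) ,
       (λ { ≡.refl k≢i k≢j → trans (B≈ k j) (pivoted-kj k≢i k≢j) }) ,
       (λ { ≡.refl → trans (B≈ k k) (pivoted-diag k) }) ,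
       (λ k≢i k≢j l≢i l≢j _ → trans (B≈ k l) (pivoted-kl k≢i k≢j l≢i l≢j))
  where
  open Field F
  open MatrixProperties F using (skewSymmetric-resp)
  open Pivot F A i j skew (<⇒≢ i<j) aᵢⱼ≉0
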